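{- Let $m,n\ge 2$. If $C$ is any maximal configuration on the $m\times n$ grid, then $$|C|\le E_{m,n}\le\begin{cases} mn-\left\lfloor\frac{n}{4}\right\rfloor(m-1), & \text{if } n\not\equiv 3\pmod 4,\\ mn-\left\lfloor\frac{n}{4}\right\rfloor(m-1)-\left\lfloor\frac{m}{2}\right\rfloor, & \text{if } n\equiv 3\pmod 4.\end{cases}$$
   Context: The $m\times n$ grid is $[m]\times[n]=\{(i,j):1\le i\le m,\ 1\le j\le n\}$; $(i,j)$ is the lot in row $i$ and column $j$, rows counted from the north (row $m$ southernmost) and columns from the west. A configuration is a subset $C\subseteq[m]\times[n]$ (the occupied lots); $|C|$ is its occupancy. A house at $(i,j)\in C$ is blocked from sunlight if $(i,j+1)$, $(i,j-1)$, $(i+1,j)$ all lie in the grid and are all occupied (lots outside the grid never obstruct sunlight). A configuration is permissible if no house in it is blocked; it is maximal if it is permissible and no permissible configuration strictly contains it. $E_{m,n}$ denotes the maximum of $|C|$ over all maximal configurations $C$ on the $m\times n$ grid. -}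

module Defs where

open import Data.Nat using (ℕ; zero; suc; _+_)
open import Data.Bool using (Bool; true; false)
open import Data.Fin using (Fin; toℕ)
import Data.Fin as F
open import Data.Product using (Σ; _×_; ∃)
open import Relation.Binary.PropositionalEquality using (_≡_)
open import Relation.Nullary using (¬_)

-- A configuration on the m × n grid: C i j ≡ true iff lot (i,j) is occupied.
-- Rows i : Fin m, 0-based, row 0 northernmost; columns j : Fin n, 0-based, column 0 westernmost.
-- (Paper's lot (i,j) corresponds to (i-1, j-1) here.)
Config : ℕ → ℕ → Set
Config m n = Fin m → Fin n → Bool

countB : ∀ {k} → (Fin k → Bool) → ℕ
countB {zero}  f = 0
countB {suc k} f with f F.zero
... | true  = suc (countB (λ i → f (F.suc i)))
... | false = countB (λ i → f (F.suc i))

occupancy : ∀ {m n} → Config m n → ℕ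
occupancy {zero}  C = 0
occupancy {suc m} C = countB (C F.zero) + occupancy (λ i → C (F.suc i))

Blocked : ∀ {m n} → Config m n → Fin m → Fin n → Set
Blocked {m} {n} C i j =
  C i j ≡ true ×
  Σ (Fin n) λ je → Σ (Fin n) λ jw → Σ (Fin m) λ is →
    toℕ je ≡ suc (toℕ j) × toℕ j ≡ suc (toℕ jw) × toℕ is ≡ suc (toℕ i) ×
    C i je ≡ true × C i jw ≡ true × C is j ≡ true

Permissible : ∀ {m n} → Config m n → Set
Permissible C = ∀ i j → ¬ Blocked C i j

_⊆C_ : ∀ {m n} → Config m n → Config m n → Set
C ⊆C D = ∀ i j → C i j ≡ true → D i j ≡ true

Maximal : ∀ {m n} → Config m n → Set
Maximal C = Permissible C × (∀ D → Permissible D → C ⊆C D → D ⊆C C)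

IsE : ℕ → ℕ → ℕ → Set
IsE m n e = (Σ (Config m n) λ C → Maximal C × occupancy C ≡ e)
          × (∀ (C : Config m n) → Maximal C → occupancy C Data.Nat.≤ e)
  where import Data.Nat

{-# OPTIONS --safe #-}
-- Count vacant lots instead of houses.  Cut every row into ⌊n/4⌋ aligned blocks of four
-- lots.  A fully occupied block forces the two lots south of its middle houses to be vacant,
-- so the block below it has at least two vacancies.  Give a block one unit of credit when it
-- has at least two vacancies; then vacancies + credit below ≥ 1 + credit for every block
-- above the last row, and telescoping down each column of blocks yields ⌊n/4⌋(m-1)
-- vacancies.  If n ≡ 3 (mod 4), a fully occupied leftover triple forces a vacancy under its
-- middle house, so no two consecutive rows have full triples: another ⌊m/2⌋ vacancies.
-- The bound holds for every permissible configuration, so it applies to any maximal one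
-- realising E_{m,n}.
module Submission where

open import Defs
open import Data.Nat using (ℕ; zero; suc; _+_; _*_; _∸_; _/_; _%_; _≤_; _<_; z≤n; s≤s)
open import Data.Nat.Properties
open import Data.Nat.DivMod using (m≡m%n+[m/n]*n; m<n*o⇒m/o<n)
open import Algebra.Properties.CommutativeSemigroup +-commutativeSemigroup
  using (interchange; x∙yz≈y∙xz; xy∙z≈xz∙y)
open import Data.Bool using (Bool; true; false)
open import Data.Fin using (Fin; toℕ)
import Data.Fin as F
open import Data.Vec using (Vec; []; _∷_; _++_; tabulate; drop)
open import Data.List using (List; []; _∷_; length; map)
open import Data.Nat.ListAction using (sum)
open import Data.List.Properties using (length-map; map-cong)
open import Data.List.Relation.Unary.Linked using (Linked; []; [-]; _∷_)
import Data.List.Relation.Unary.Linked as Linked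
open import Data.List.Relation.Unary.Linked.Properties using (map⁺)
open import Data.Product using (_×_; _,_; proj₁; proj₂; map₁)
open import Data.Empty using (⊥; ⊥-elim)
open import Data.Unit using (⊤; tt)
open import Function using (_∘_; const)
open import Relation.Binary.PropositionalEquality
  using (_≡_; _≢_; refl; sym; trans; cong; cong₂; subst; module ≡-Reasoning)

sum-map-+ : ∀ {A : Set} (f g : A → ℕ) xs →
  sum (map (λ x → f x + g x) xs) ≡ sum (map f xs) + sum (map g xs)
sum-map-+ f g []       = refl
sum-map-+ f g (x ∷ xs) = trans (cong (f x + g x +_) (sum-map-+ f g xs)) (interchange (f x) _ _ _)

telescope : ∀ {A : Set} (f g : A → ℕ) k → (∀ x → f x ≤ g x) →
  ∀ {xs} → Linked (λ x y → k + f x ≤ g x + f y) xs → k * (length xs ∸ 1) ≤ sum (map g xs)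
telescope f g k f≤g []     = ≤-reflexive (*-zeroʳ k)
telescope f g k f≤g {x ∷ xs} linked = begin
  k * length xs            ≤⟨ m≤m+n _ _ ⟩
  k * length xs + f x      ≡⟨ cong (_+ f x) (*-comm k (length xs)) ⟩
  length xs * k + f x      ≤⟨ telescope-∷ linked ⟩
  sum (map g (x ∷ xs))     ∎
  where
    open ≤-Reasoning
    telescope-∷ : ∀ {x xs} → Linked (λ x y → k + f x ≤ g x + f y) (x ∷ xs) →
      length xs * k + f x ≤ sum (map g (x ∷ xs))
    telescope-∷ {x} [-] = ≤-trans (f≤g x) (≤-reflexive (sym (+-identityʳ (g x))))
    telescope-∷ {x} {y ∷ xs} (step ∷ linked) = begin
      (k + length xs * k) + f x  ≡⟨ xy∙z≈xz∙y k _ (f x) ⟩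
      (k + f x) + length xs * k  ≤⟨ +-monoˡ-≤ _ step ⟩
      (g x + f y) + length xs * k ≡⟨ +-assoc (g x) (f y) _ ⟩
      g x + (f y + length xs * k) ≡⟨ cong (g x +_) (+-comm (f y) _) ⟩
      g x + (length xs * k + f y) ≤⟨ +-monoʳ-≤ (g x) (telescope-∷ linked) ⟩
      g x + sum (map g (y ∷ xs)) ∎

half-length≤sum : ∀ {xs} → Linked (λ x y → x ≡ 0 → 0 < y) xs → length xs / 2 ≤ sum xs
half-length≤sum []              = z≤n
half-length≤sum {x ∷ xs} linked =
  ≤-pred (m<n*o⇒m/o<n {o = 2} (s≤s (s≤s (proj₁ (length≤2*sum linked)))))
  where
    length≤2*sum : ∀ {x xs} → Linked (λ x y → x ≡ 0 → 0 < y) (x ∷ xs) →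
      length xs ≤ sum (x ∷ xs) * 2 × (0 < x → suc (length xs) ≤ sum (x ∷ xs) * 2)
    length≤2*sum {zero}  [-] = z≤n , λ ()
    length≤2*sum {suc k} [-] = z≤n , const (s≤s z≤n)
    length≤2*sum {zero}  (step ∷ linked) = proj₂ (length≤2*sum linked) (step refl) , λ ()
    length≤2*sum {suc k} {y ∷ ys} (step ∷ linked) = ≤-trans (n≤1+n _) long , const long
      where
        long : suc (suc (length ys)) ≤ (suc k + sum (y ∷ ys)) * 2
        long = s≤s (s≤s (≤-trans (proj₁ (length≤2*sum linked))
                                 (*-monoˡ-≤ 2 (m≤n+m (sum (y ∷ ys)) k))))

vacancies : ∀ {n} → Vec Bool n → ℕ
vacancies []          = 0
vacancies (true ∷ r)  = vacancies r
vacancies (false ∷ r) = suc (vacancies r)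

vacancies-++ : ∀ {k n} (r : Vec Bool k) (s : Vec Bool n) →
  vacancies (r ++ s) ≡ vacancies r + vacancies s
vacancies-++ []          s = refl
vacancies-++ (true ∷ r)  s = vacancies-++ r s
vacancies-++ (false ∷ r) s = cong suc (vacancies-++ r s)

countB+vacancies : ∀ {n} (f : Fin n → Bool) → countB f + vacancies (tabulate f) ≡ n
countB+vacancies {zero}  f = refl
countB+vacancies {suc n} f with f F.zero
... | true  = cong suc (countB+vacancies (f ∘ F.suc))
... | false = trans (+-suc _ _) (cong suc (countB+vacancies (f ∘ F.suc)))

rows : ∀ {m n} → Config m n → List (Vec Bool n)
rows {zero}  C = []
rows {suc m} C = tabulate (C F.zero) ∷ rows (C ∘ F.suc)

length-rows : ∀ {m n} (C : Config m n) → length (rows C) ≡ m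
length-rows {zero}  C = refl
length-rows {suc m} C = cong suc (length-rows (C ∘ F.suc))

occupancy+vacancies : ∀ {m n} (C : Config m n) →
  occupancy C + sum (map vacancies (rows C)) ≡ m * n
occupancy+vacancies {zero}      C = refl
occupancy+vacancies {suc m} {n} C = begin
  (countB (C F.zero) + occupancy C′) + (vacancies (tabulate (C F.zero)) + sum (map vacancies (rows C′)))
    ≡⟨ interchange (countB (C F.zero)) _ _ _ ⟩
  (countB (C F.zero) + vacancies (tabulate (C F.zero))) + (occupancy C′ + sum (map vacancies (rows C′)))
    ≡⟨ cong₂ _+_ (countB+vacancies (C F.zero)) (occupancy+vacancies C′) ⟩
  n + m * n ∎
  where
    open ≡-Reasoning
    C′ = C ∘ F.suc

-- Row s lies directly south of row r, and no house of r is blocked.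
Sunlit : ∀ {n} → Vec Bool n → Vec Bool n → Set
Sunlit (a ∷ b ∷ c ∷ r) (_ ∷ y ∷ s) =
  (a ≡ true → b ≡ true → c ≡ true → y ≡ true → ⊥) × Sunlit (b ∷ c ∷ r) (y ∷ s)
Sunlit _ _ = ⊤

Sunlit-tail : ∀ {n a x} {r s : Vec Bool n} → Sunlit (a ∷ r) (x ∷ s) → Sunlit r s
Sunlit-tail {r = []}                        _       = tt
Sunlit-tail {r = _ ∷ []}                    _       = tt
Sunlit-tail {r = _ ∷ _ ∷ _} {s = _ ∷ _ ∷ _} (_ , h) = h

Sunlit-drop : ∀ k {t} {r s : Vec Bool (k + t)} → Sunlit r s → Sunlit (drop k r) (drop k s)
Sunlit-drop zero    h = h
Sunlit-drop (suc k) {r = _ ∷ _} {s = _ ∷ _} h = Sunlit-drop k (Sunlit-tail h)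

sunlit-tabulate : ∀ {n} (f g : Fin n → Bool) →
  (∀ jw j je → toℕ j ≡ suc (toℕ jw) → toℕ je ≡ suc (toℕ j) →
     f jw ≡ true → f j ≡ true → f je ≡ true → g j ≡ true → ⊥) →
  Sunlit (tabulate f) (tabulate g)
sunlit-tabulate {zero}              f g H = tt
sunlit-tabulate {suc zero}          f g H = tt
sunlit-tabulate {suc (suc zero)}    f g H = tt
sunlit-tabulate {suc (suc (suc n))} f g H =
  H F.zero (F.suc F.zero) (F.suc (F.suc F.zero)) refl refl ,
  sunlit-tabulate (f ∘ F.suc) (g ∘ F.suc)
    (λ jw j je e₁ e₂ → H (F.suc jw) (F.suc j) (F.suc je) (cong suc e₁) (cong suc e₂))

permissible-south : ∀ {m n} (C : Config (suc m) n) → Permissible C → Permissible (C ∘ F.suc)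
permissible-south C P i j (house , je , jw , is , e₁ , e₂ , e₃ , east , west , south) =
  P (F.suc i) j (house , je , jw , F.suc is , e₁ , e₂ , cong suc e₃ , east , west , south)

permissible⇒sunlit-rows : ∀ {m n} (C : Config m n) → Permissible C → Linked Sunlit (rows C)
permissible⇒sunlit-rows {zero}        C P = []
permissible⇒sunlit-rows {suc zero}    C P = [-]
permissible⇒sunlit-rows {suc (suc m)} C P =
  sunlit-tabulate (C F.zero) (C (F.suc F.zero))
    (λ jw j je e₁ e₂ west house east south →
       P F.zero j (house , je , jw , F.suc F.zero , e₂ , e₁ , refl , east , west , south)) ∷
  permissible⇒sunlit-rows (C ∘ F.suc) (permissible-south C P)

credit : ℕ → ℕ
credit zero                = 0
credit (suc zero)          = 0
credit (suc (suc _))       = 1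

credit≤ : ∀ k → credit k ≤ k
credit≤ zero          = z≤n
credit≤ (suc zero)    = z≤n
credit≤ (suc (suc k)) = s≤s z≤n

credit-suc≤ : ∀ k → credit (suc k) ≤ k
credit-suc≤ zero    = z≤n
credit-suc≤ (suc k) = s≤s z≤n

credit-step-vacant : ∀ k l → 1 + credit (suc k) ≤ suc k + l
credit-step-vacant k l = s≤s (≤-trans (credit-suc≤ k) (m≤m+n k l))

credit-step : ∀ {r s : Vec Bool 4} → Sunlit r s →
  1 + credit (vacancies r) ≤ vacancies r + credit (vacancies s)
credit-step {false ∷ _}                        _ = credit-step-vacant _ _
credit-step {true ∷ false ∷ _}                 _ = credit-step-vacant _ _
credit-step {true ∷ true ∷ false ∷ _}          _ = credit-step-vacant _ _
credit-step {true ∷ true ∷ true ∷ false ∷ []}  _ = credit-step-vacant 0 _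
credit-step {true ∷ true ∷ true ∷ true ∷ []} {_ ∷ true ∷ _} (blocked , _) =
  ⊥-elim (blocked refl refl refl refl)
credit-step {true ∷ true ∷ true ∷ true ∷ []} {_ ∷ false ∷ true ∷ _} (_ , blocked , _) =
  ⊥-elim (blocked refl refl refl refl)
credit-step {true ∷ true ∷ true ∷ true ∷ []} {true  ∷ false ∷ false ∷ _} _ = s≤s z≤n
credit-step {true ∷ true ∷ true ∷ true ∷ []} {false ∷ false ∷ false ∷ _} _ = s≤s z≤n

blockVacancies : ∀ q {t} → Vec Bool (q * 4 + t) → ℕ
blockVacancies zero    _                   = 0
blockVacancies (suc q) (a ∷ b ∷ c ∷ d ∷ r) = vacancies (a ∷ b ∷ c ∷ d ∷ []) + blockVacancies q r

blockCredit : ∀ q {t} → Vec Bool (q * 4 + t) → ℕ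
blockCredit zero    _                   = 0
blockCredit (suc q) (a ∷ b ∷ c ∷ d ∷ r) = credit (vacancies (a ∷ b ∷ c ∷ d ∷ [])) + blockCredit q r

blockCredit≤blockVacancies : ∀ q {t} (r : Vec Bool (q * 4 + t)) → blockCredit q r ≤ blockVacancies q r
blockCredit≤blockVacancies zero    _                   = z≤n
blockCredit≤blockVacancies (suc q) (a ∷ b ∷ c ∷ d ∷ r) =
  +-mono-≤ (credit≤ _) (blockCredit≤blockVacancies q r)

vacancies-split : ∀ q {t} (r : Vec Bool (q * 4 + t)) →
  vacancies r ≡ blockVacancies q r + vacancies (drop (q * 4) r)
vacancies-split zero    r                   = refl
vacancies-split (suc q) (a ∷ b ∷ c ∷ d ∷ r) = begin
  vacancies (a ∷ b ∷ c ∷ d ∷ r)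
    ≡⟨ vacancies-++ (a ∷ b ∷ c ∷ d ∷ []) r ⟩
  vacancies (a ∷ b ∷ c ∷ d ∷ []) + vacancies r
    ≡⟨ cong (vacancies (a ∷ b ∷ c ∷ d ∷ []) +_) (vacancies-split q r) ⟩
  vacancies (a ∷ b ∷ c ∷ d ∷ []) + (blockVacancies q r + vacancies (drop (q * 4) r))
    ≡⟨ +-assoc (vacancies (a ∷ b ∷ c ∷ d ∷ [])) (blockVacancies q r) _ ⟨
  blockVacancies (suc q) (a ∷ b ∷ c ∷ d ∷ r) + vacancies (drop (q * 4) r) ∎
  where open ≡-Reasoning

blocks-step : ∀ q {t} {r s : Vec Bool (q * 4 + t)} → Sunlit r s →
  q + blockCredit q r ≤ blockVacancies q r + blockCredit q s
blocks-step zero _ = z≤n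
blocks-step (suc q) {r = a ∷ b ∷ c ∷ d ∷ r} {s = w ∷ x ∷ y ∷ z ∷ s} (west , east , sunlit) = begin
  suc q + (credit (vacancies top) + blockCredit q r)
    ≡⟨ cong suc (x∙yz≈y∙xz q (credit (vacancies top)) (blockCredit q r)) ⟩
  (1 + credit (vacancies top)) + (q + blockCredit q r)
    ≤⟨ +-mono-≤ (credit-step {top} {bottom} (west , east , tt))
                (blocks-step q (Sunlit-tail (Sunlit-tail sunlit))) ⟩
  (vacancies top + credit (vacancies bottom)) + (blockVacancies q r + blockCredit q s)
    ≡⟨ interchange (vacancies top) (credit (vacancies bottom)) (blockVacancies q r) _ ⟩
  (vacancies top + blockVacancies q r) + (credit (vacancies bottom) + blockCredit q s) ∎
  where
    open ≤-Reasoning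
    top bottom : Vec Bool 4
    top    = a ∷ b ∷ c ∷ d ∷ []
    bottom = w ∷ x ∷ y ∷ z ∷ []

full-triple⇒vacancy-south : ∀ {r s : Vec Bool 3} → Sunlit r s → vacancies r ≡ 0 → 0 < vacancies s
full-triple⇒vacancy-south {true ∷ true ∷ true ∷ []} {_ ∷ true ∷ _ ∷ []} (blocked , _) _ =
  ⊥-elim (blocked refl refl refl refl)
full-triple⇒vacancy-south {true ∷ true ∷ true ∷ []} {true  ∷ false ∷ _ ∷ []} _ _ = s≤s z≤n
full-triple⇒vacancy-south {true ∷ true ∷ true ∷ []} {false ∷ false ∷ _ ∷ []} _ _ = s≤s z≤n
full-triple⇒vacancy-south {false ∷ _}                _ ()
full-triple⇒vacancy-south {true ∷ false ∷ _}         _ ()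
full-triple⇒vacancy-south {true ∷ true ∷ false ∷ _}  _ ()

occupancy-bound-blocks : ∀ {m} q t (C : Config m (q * 4 + t)) → Permissible C →
    occupancy C + q * (m ∸ 1) ≤ m * (q * 4 + t)
  × (t ≡ 3 → occupancy C + q * (m ∸ 1) + m / 2 ≤ m * (q * 4 + t))
occupancy-bound-blocks {m} q t C permissible = bound , bound-3
  where
    open ≤-Reasoning
    sunlit : Linked Sunlit (rows C)
    sunlit = permissible⇒sunlit-rows C permissible

    tail : Vec Bool (q * 4 + t) → ℕ
    tail = vacancies ∘ drop (q * 4)

    B T : ℕ
    B = sum (map (blockVacancies q) (rows C))
    T = sum (map tail (rows C))

    occupancy+B+T : occupancy C + (B + T) ≡ m * (q * 4 + t)
    occupancy+B+T = begin-equality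
      occupancy C + (B + T)
        ≡⟨ cong (occupancy C +_) (sum-map-+ (blockVacancies q) tail (rows C)) ⟨
      occupancy C + sum (map (λ r → blockVacancies q r + tail r) (rows C))
        ≡⟨ cong (λ v → occupancy C + sum v) (map-cong (vacancies-split q) (rows C)) ⟨
      occupancy C + sum (map vacancies (rows C))
        ≡⟨ occupancy+vacancies C ⟩
      m * (q * 4 + t) ∎

    blocks : q * (m ∸ 1) ≤ B
    blocks = subst (λ k → q * (k ∸ 1) ≤ B) (length-rows C)
      (telescope (blockCredit q) (blockVacancies q) q (blockCredit≤blockVacancies q)
        (Linked.map (blocks-step q) sunlit))

    bound : occupancy C + q * (m ∸ 1) ≤ m * (q * 4 + t)
    bound = begin
      occupancy C + q * (m ∸ 1) ≤⟨ +-monoʳ-≤ (occupancy C) (≤-trans blocks (m≤m+n B T)) ⟩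
      occupancy C + (B + T)     ≡⟨ occupancy+B+T ⟩
      m * (q * 4 + t)           ∎

    bound-3 : t ≡ 3 → occupancy C + q * (m ∸ 1) + m / 2 ≤ m * (q * 4 + t)
    bound-3 refl = begin
      occupancy C + q * (m ∸ 1) + m / 2 ≤⟨ +-mono-≤ (+-monoʳ-≤ (occupancy C) blocks) tails ⟩
      occupancy C + B + T               ≡⟨ +-assoc (occupancy C) B T ⟩
      occupancy C + (B + T)             ≡⟨ occupancy+B+T ⟩
      m * (q * 4 + 3)                   ∎
      where
        tails : m / 2 ≤ T
        tails = subst (λ k → k / 2 ≤ T) (trans (length-map tail (rows C)) (length-rows C))
          (half-length≤sum (map⁺ (Linked.map tail-step sunlit)))
          where
            tail-step : ∀ {r s} → Sunlit r s → tail r ≡ 0 → 0 < tail s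
            tail-step {r} {s} sunlit-rs =
              full-triple⇒vacancy-south {drop (q * 4) r} {drop (q * 4) s} (Sunlit-drop (q * 4) sunlit-rs)

occupancy-bound : ∀ {m} n (C : Config m n) → Permissible C →
    occupancy C + n / 4 * (m ∸ 1) ≤ m * n
  × (n % 4 ≡ 3 → occupancy C + n / 4 * (m ∸ 1) + m / 2 ≤ m * n)
occupancy-bound {m} n = subst (λ k → (C : Config m k) → Permissible C →
      occupancy C + n / 4 * (m ∸ 1) ≤ m * k
    × (n % 4 ≡ 3 → occupancy C + n / 4 * (m ∸ 1) + m / 2 ≤ m * k))
  (trans (+-comm (n / 4 * 4) (n % 4)) (sym (m≡m%n+[m/n]*n n 4)))
  (occupancy-bound-blocks (n / 4) (n % 4))

proposition4p7 : (m n : ℕ) → 2 ≤ m → 2 ≤ n → (e : ℕ) → IsE m n e →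
    (C : Config m n) → Maximal C →
      occupancy C ≤ e ×
      (n % 4 ≢ 3 → e + (n / 4) * (m ∸ 1) ≤ m * n) ×
      (n % 4 ≡ 3 → e + (n / 4) * (m ∸ 1) + m / 2 ≤ m * n)
proposition4p7 m n _ _ e ((C₀ , (permissible₀ , _) , refl) , maximum) C maximal =
  maximum C maximal , map₁ const (occupancy-bound n C₀ permissible₀)
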